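{- Let $k,\ell,m$ be positive integers with $\ell\ne m$, and write $q:=2^k$, $Q:=2^\ell$, $R:=2^m$. Let $u$ be an integer and let $d_1,d_2,d_3$ be positive integers such that \[ d_1\equiv Q-R+u(q+1),\quad d_2\equiv Q+R+(u-R)(q+1),\quad d_3\equiv -(Q+R)+(u+Q)(q+1)\pmod{q^2-1}, \] and suppose $\gcd(d_1,q^2-1)=1$. Let $f(X):=X^{d_1}+X^{d_2}+X^{d_3}\in\mathbb{F}_{q^2}[X]$. Then there exist a positive integer $n$ such that $T:=2^n$ satisfies $\gcd(T-1,q+1)=1$, and positive integers $r,s$ with $r(T-1)\equiv T\pmod{q+1}$ and $s(T-1)\equiv -1\pmod{q+1}$, such that $f(X)$ is multiplicatively equivalent (over $\mathbb{F}_{q^2}$) to $g(X):=X+X^{1+r(q-1)}+X^{1+s(q-1)}$.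
   Context: Two polynomials $f,g\in\mathbb{F}_{q^2}[X]$ are called multiplicatively equivalent if $f(X)\equiv \alpha\, g(\beta X^N)\pmod{X^{q^2}-X}$ for some $\alpha,\beta\in\mathbb{F}_{q^2}^*$ and some positive integer $N$ with $\gcd(N,q^2-1)=1$. -}

module Defs where

open import Level using (Level; suc; _⊔_)
open import Algebra.Bundles using (CommutativeRing)
open import Data.Nat as ℕ using (ℕ; zero; _∸_; _%_; _≟_)
open import Data.Fin using (Fin)
open import Data.Nat.GCD using (gcd)
open import Data.Integer as ℤ using (ℤ)
open import Data.Integer.Divisibility using (_∣_)
open import Data.List using (List; []; _∷_; map)
open import Data.Product using (Σ; ∃; _×_; _,_)
open import Relation.Nullary using (¬_; yes; no)
open import Relation.Binary.PropositionalEquality using (_≡_)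

_≡_[modℤ_] : ℤ → ℤ → ℤ → Set
a ≡ b [modℤ m ] = m ∣ (a ℤ.- b)

record FiniteField (c ℓ : Level) (n : ℕ) : Set (suc (c ⊔ ℓ)) where
  field
    commRing : CommutativeRing c ℓ
  open CommutativeRing commRing public
  field
    0≉1     : ¬ (0# ≈ 1#)
    inverse : ∀ x → ¬ (x ≈ 0#) → ∃ λ y → x * y ≈ 1#
    enum    : Fin n → Carrier
    enum-surj : ∀ x → ∃ λ i → enum i ≈ x
    enum-inj  : ∀ i j → enum i ≈ enum j → i ≡ j

module Poly {c ℓ : Level} {n : ℕ} (F : FiniteField c ℓ n) where
  open FiniteField F using (Carrier; _≈_; _+_; _*_; 0#; 1#; semiring)
  open import Algebra.Properties.Semiring.Exp semiring using (_^_)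

  -- A (sparse) polynomial: a finite list of terms  coefficient · X^exponent.
  Term : Set c
  Term = Carrier × ℕ

  Pol : Set c
  Pol = List Term

  mono : ℕ → Term
  mono e = (1# , e)

  -- Reduction of an exponent modulo X^n - X (n = field size, n ≥ 2):
  -- X^0 stays, X^e for e ≥ 1 becomes X^e' with 1 ≤ e' ≤ n-1, e' ≡ e mod (n-1).
  redExp : ℕ → ℕ
  redExp zero = zero
  redExp (ℕ.suc e) with n ∸ 1
  ... | zero     = ℕ.suc e
  ... | ℕ.suc m  = ℕ.suc (e % ℕ.suc m)

  coeffRed : Pol → ℕ → Carrier
  coeffRed [] j = 0#
  coeffRed ((a , e) ∷ p) j with redExp e ≟ j
  ... | yes _ = a + coeffRed p j
  ... | no  _ = coeffRed p j

  _≡Red_ : Pol → Pol → Set ℓ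
  p ≡Red q = ∀ j → coeffRed p j ≈ coeffRed q j

  scaleSubst : Carrier → Carrier → ℕ → Pol → Pol
  scaleSubst α β N g = map (λ { (a , e) → (α * (a * (β ^ e)) , N ℕ.* e) }) g

  MultEquiv : Pol → Pol → Set (c ⊔ ℓ)
  MultEquiv f g = Σ Carrier λ α → Σ Carrier λ β → Σ ℕ λ N →
    ¬ (α ≈ 0#) × ¬ (β ≈ 0#) × 1 ℕ.≤ N × gcd N (n ∸ 1) ≡ 1 ×
    (f ≡Red scaleSubst α β N g)

{-# OPTIONS --safe #-}
-- Take α = β = 1 and N = d₁. If a inverts d₁ modulo q² − 1, put r ≡ −R·a and s ≡ Q·a (mod q + 1).
-- Since d₂ − d₁ ≡ (q − 1)(−R) and d₃ − d₁ ≡ (q − 1)Q (mod q² − 1), while d₁r ≡ −R and d₁s ≡ Q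
-- (mod q + 1), multiplying by q − 1 gives d₁(1 + r(q − 1)) ≡ d₂ and d₁(1 + s(q − 1)) ≡ d₃
-- (mod q² − 1): the substitution X ↦ X^d₁ turns g into f. For T = 2^(m + l(2k − 1)) we have
-- Q·T = R·q^(2l) ≡ R (mod q + 1), because q ≡ −1; with a(Q − R) ≡ ad₁ ≡ 1 this yields
-- r(T − 1) ≡ T and s(T − 1) ≡ −1, the latter also showing gcd(T − 1, q + 1) = 1.
module Submission where

open import Defs
open import Data.Empty using (⊥-elim)
open import Data.Integer as ℤ using (ℤ; +_; _+_; _-_; _*_; -_; _%ℕ_; _/ℕ_)
import Data.Integer.Properties as ℤ
open import Data.Integer.DivMod using (a≡a%ℕn+[a/ℕn]*n)
open import Data.Integer.Divisibility.Signed as Signed using (divides; ∣ᵤ⇒∣; ∣⇒∣ᵤ)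
open import Data.Integer.Tactic.RingSolver using (solve-∀; solve)
open import Data.List using (List; _∷_; []; map)
open import Data.List.Relation.Binary.Pointwise as Pointwise using (Pointwise)
open import Data.Nat as ℕ using (ℕ; zero; suc; _^_; _∸_; _<_; _≤_; _%_; z≤n; s≤s; NonZero; >-nonZero)
import Data.Nat.Properties as ℕ
open import Data.Nat.Coprimality using (coprime⇒gcd≡1; gcd≡1⇒coprime; coprime-Bézout)
open import Data.Nat.DivMod using (%-remove-+ˡ)
open import Data.Nat.Divisibility as ℕ using (∣1⇒≡1; 0∣⇒≡0)
open import Data.Nat.GCD using (gcd; module Bézout)
import Data.Nat.Tactic.RingSolver as ℕ-Solver
open import Data.Product using (Σ; _×_; _,_; proj₁; proj₂)
open import Data.Sum using (inj₁; inj₂)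
open import Function using (_∘_)
open import Relation.Binary.Bundles using (Setoid)
open import Relation.Binary.PropositionalEquality using (_≡_; _≢_; refl; sym; trans; cong; subst; module ≡-Reasoning)
import Relation.Binary.Reasoning.Setoid as SetoidReasoning
open import Relation.Binary.Structures using (IsEquivalence)
open import Relation.Nullary using (¬_; yes; no)

-- Unlike _≡_[modℤ_], which unfolds to ∣ m ∣ ∣ ∣ a - b ∣, this record keeps a, b and m
-- recoverable from its type, so congruence proofs compose without annotations.
infix 4 _≈_[mod_]
record _≈_[mod_] (a b m : ℤ) : Set where
  constructor mod-by
  field m∣a-b : m Signed.∣ (a - b)
open _≈_[mod_] public

private
  _by_ : ∀ {m x a b} → m Signed.∣ x → x ≡ a - b → a ≈ b [mod m ]
  _by_ {m} m∣x eq = mod-by (subst (m Signed.∣_) eq m∣x)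

module _ {m : ℤ} where

  fromModℤ : ∀ {a b} → a ≡ b [modℤ m ] → a ≈ b [mod m ]
  fromModℤ = mod-by ∘ ∣ᵤ⇒∣

  toModℤ : ∀ {a b} → a ≈ b [mod m ] → a ≡ b [modℤ m ]
  toModℤ (mod-by m∣a-b) = ∣⇒∣ᵤ m∣a-b

  +-multiple≈-mod : ∀ a k → a + k * m ≈ a [mod m ]
  +-multiple≈-mod a k = mod-by (divides k (solve (a ∷ k ∷ m ∷ [])))

  ≈-mod-reflexive : ∀ {a b} → a ≡ b → a ≈ b [mod m ]
  ≈-mod-reflexive {a} refl = Signed.∣n⇒∣m*n (+ 0) Signed.∣-refl by solve (m ∷ a ∷ [])

  ≈-mod-refl : ∀ {a} → a ≈ a [mod m ]
  ≈-mod-refl = ≈-mod-reflexive refl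

  ≈-mod-sym : ∀ {a b} → a ≈ b [mod m ] → b ≈ a [mod m ]
  ≈-mod-sym {a} {b} (mod-by m∣a-b) = Signed.∣m⇒∣-m m∣a-b by solve (a ∷ b ∷ [])

  ≈-mod-trans : ∀ {a b c} → a ≈ b [mod m ] → b ≈ c [mod m ] → a ≈ c [mod m ]
  ≈-mod-trans {a} {b} {c} (mod-by m∣a-b) (mod-by m∣b-c) =
    Signed.∣m∣n⇒∣m+n m∣a-b m∣b-c by solve (a ∷ b ∷ c ∷ [])

  +-cong-mod : ∀ {a b c d} → a ≈ b [mod m ] → c ≈ d [mod m ] → a + c ≈ b + d [mod m ]
  +-cong-mod {a} {b} {c} {d} (mod-by m∣a-b) (mod-by m∣c-d) =
    Signed.∣m∣n⇒∣m+n m∣a-b m∣c-d by solve (a ∷ b ∷ c ∷ d ∷ [])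

  *-cong-mod : ∀ {a b c d} → a ≈ b [mod m ] → c ≈ d [mod m ] → a * c ≈ b * d [mod m ]
  *-cong-mod {a} {b} {c} {d} (mod-by m∣a-b) (mod-by m∣c-d) =
    Signed.∣m∣n⇒∣m+n (Signed.∣m⇒∣m*n c m∣a-b) (Signed.∣n⇒∣m*n b m∣c-d)
      by solve (a ∷ b ∷ c ∷ d ∷ [])

  -‿cong-mod : ∀ {a b} → a ≈ b [mod m ] → - a ≈ - b [mod m ]
  -‿cong-mod {a} {b} (mod-by m∣a-b) = Signed.∣m⇒∣-m m∣a-b by solve (a ∷ b ∷ [])

  +-cancelˡ-mod : ∀ c {a b} → c + a ≈ c + b [mod m ] → a ≈ b [mod m ]
  +-cancelˡ-mod c {a} {b} (mod-by m∣c+a-[c+b]) = m∣c+a-[c+b] by solve (c ∷ a ∷ b ∷ [])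

  +-congʳ-mod : ∀ a {b c} → b ≈ c [mod m ] → b + a ≈ c + a [mod m ]
  +-congʳ-mod a b≈c = +-cong-mod b≈c (≈-mod-refl {a})

  *-congˡ-mod : ∀ a {b c} → b ≈ c [mod m ] → a * b ≈ a * c [mod m ]
  *-congˡ-mod a = *-cong-mod (≈-mod-refl {a})

≈-mod-isEquivalence : ∀ m → IsEquivalence (_≈_[mod m ])
≈-mod-isEquivalence m = record { refl = ≈-mod-refl ; sym = ≈-mod-sym ; trans = ≈-mod-trans }

≈-mod-setoid : ℤ → Setoid _ _
≈-mod-setoid m = record { isEquivalence = ≈-mod-isEquivalence m }

module ≈-mod-Reasoning (m : ℤ) = SetoidReasoning (≈-mod-setoid m)

≈-mod-divisor : ∀ {d m a b} → d Signed.∣ m → a ≈ b [mod m ] → a ≈ b [mod d ]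
≈-mod-divisor d∣m (mod-by m∣a-b) = mod-by (Signed.∣-trans d∣m m∣a-b)

*-scale-mod : ∀ {m a b} c → a ≈ b [mod m ] → c * a ≈ c * b [mod c * m ]
*-scale-mod {m} {a} {b} c (mod-by m∣a-b) =
  cm∣c[a-b] by solve (c ∷ a ∷ b ∷ [])
  where
  cm∣c[a-b] : c * m Signed.∣ c * (a - b)
  cm∣c[a-b] = Signed.*-monoʳ-∣ c m∣a-b

≈-mod-0⇒≡ : ∀ {e f} → + e ≈ + f [mod + 0 ] → e ≡ f
≈-mod-0⇒≡ {e} {f} (mod-by 0∣e-f) =
  ℤ.+-injective (ℤ.i-j≡0⇒i≡j (+ e) (+ f) (ℤ.∣i∣≡0⇒i≡0 (0∣⇒≡0 (∣⇒∣ᵤ 0∣e-f))))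

private
  ≈-mod⇒%≡-ordered : ∀ d .{{_ : NonZero d}} {e f} → f ≤ e → + e ≈ + f [mod + d ] → e % d ≡ f % d
  ≈-mod⇒%≡-ordered d {e} {f} f≤e (mod-by d∣e-f) = begin
    e % d             ≡⟨ cong (_% d) (ℕ.m∸n+n≡m f≤e) ⟨
    (e ∸ f ℕ.+ f) % d ≡⟨ %-remove-+ˡ f d∣e∸f ⟩
    f % d             ∎
    where
    open ≡-Reasoning
    d∣e∸f : d ℕ.∣ e ∸ f
    d∣e∸f = ∣⇒∣ᵤ (subst (+ d Signed.∣_) (trans (ℤ.m-n≡m⊖n e f) (ℤ.⊖-≥ f≤e)) d∣e-f)

≈-mod⇒%≡ : ∀ d .{{_ : NonZero d}} {e f} → + e ≈ + f [mod + d ] → e % d ≡ f % d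
≈-mod⇒%≡ d {e} {f} e≈f with ℕ.≤-total f e
... | inj₁ f≤e = ≈-mod⇒%≡-ordered d f≤e e≈f
... | inj₂ e≤f = sym (≈-mod⇒%≡-ordered d e≤f (≈-mod-sym e≈f))

module _ {c ℓ n} (F : FiniteField c ℓ n) where
  private module 𝔽 = FiniteField F
  open Poly F
  open import Algebra.Properties.Semiring.Exp 𝔽.semiring using () renaming (_^_ to _^ᶠ_)

  redExp-cong : ∀ {e f} → 0 < e → 0 < f → + e ≈ + f [mod + (n ∸ 1) ] → redExp e ≡ redExp f
  redExp-cong {suc e} {suc f} _ _ 1+e≈1+f with n ∸ 1
  ... | zero    = ≈-mod-0⇒≡ 1+e≈1+f
  ... | suc n-2 = cong suc (≈-mod⇒%≡ (suc n-2) {e} {f} (+-cancelˡ-mod (+ 1) 1+e≈1+f))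

  _≈ᵀ_ : Term → Term → Set ℓ
  (a , e) ≈ᵀ (b , f) = a 𝔽.≈ b × redExp e ≡ redExp f

  coeffRed-cong : ∀ {p p′} → Pointwise _≈ᵀ_ p p′ → p ≡Red p′
  coeffRed-cong Pointwise.[] j = 𝔽.refl
  coeffRed-cong {(a , e) ∷ _} {(b , f) ∷ _} ((a≈b , e∼f) Pointwise.∷ rest) j
    with redExp e ℕ.≟ j | redExp f ℕ.≟ j
  ... | yes _   | yes _   = 𝔽.+-cong a≈b (coeffRed-cong rest j)
  ... | no _    | no _    = coeffRed-cong rest j
  ... | yes e≡j | no f≢j  = ⊥-elim (f≢j (trans (sym e∼f) e≡j))
  ... | no e≢j  | yes f≡j = ⊥-elim (e≢j (trans e∼f f≡j))

  1#^e≈1# : ∀ e → 𝔽.1# ^ᶠ e 𝔽.≈ 𝔽.1#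
  1#^e≈1# zero    = 𝔽.refl
  1#^e≈1# (suc e) = 𝔽.trans (𝔽.*-identityˡ _) (1#^e≈1# e)

  1#*[1#*1#^e]≈1# : ∀ e → 𝔽.1# 𝔽.* (𝔽.1# 𝔽.* 𝔽.1# ^ᶠ e) 𝔽.≈ 𝔽.1#
  1#*[1#*1#^e]≈1# e = 𝔽.trans (𝔽.*-identityˡ _) (𝔽.trans (𝔽.*-identityˡ _) (1#^e≈1# e))

  monomials-multEquiv : ∀ N (es fs : List ℕ) → 1 ≤ N → gcd N (n ∸ 1) ≡ 1 →
    Pointwise (λ e f → redExp e ≡ redExp (N ℕ.* f)) es fs → MultEquiv (map mono es) (map mono fs)
  monomials-multEquiv N es fs 1≤N gcd≡1 es∼fs =
    𝔽.1# , 𝔽.1# , N , 1≉0 , 1≉0 , 1≤N , gcd≡1 , coeffRed-cong (monomials es∼fs)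
    where
    1≉0 : ¬ (𝔽.1# 𝔽.≈ 𝔽.0#)
    1≉0 = 𝔽.0≉1 ∘ 𝔽.sym
    monomials : ∀ {es fs} → Pointwise (λ e f → redExp e ≡ redExp (N ℕ.* f)) es fs →
                Pointwise _≈ᵀ_ (map mono es) (scaleSubst 𝔽.1# 𝔽.1# N (map mono fs))
    monomials Pointwise.[]             = Pointwise.[]
    monomials {fs = f ∷ _} (e∼f Pointwise.∷ rest) =
      (𝔽.sym (1#*[1#*1#^e]≈1# f) , e∼f) Pointwise.∷ monomials rest

pos-∸ : ∀ {m n} → n ≤ m → + (m ∸ n) ≡ + m - + n
pos-∸ {m} {n} n≤m = sym (trans (ℤ.m-n≡m⊖n m n) (ℤ.⊖-≥ n≤m))

private
  pos-1+* : ∀ m n → + (1 ℕ.+ m ℕ.* n) ≡ + 1 + + m * + n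
  pos-1+* m n = cong (_+_ (+ 1)) (ℤ.pos-* m n)

  1+xd≡yM⇒[-x]d≡1+[-y]M : ∀ x d y M → + 1 + x * d ≡ y * M → - x * d ≡ + 1 + - y * M
  1+xd≡yM⇒[-x]d≡1+[-y]M x d y M 1+xd≡yM = begin
    - x * d             ≡⟨ solve (x ∷ d ∷ []) ⟩
    + 1 - (+ 1 + x * d) ≡⟨ cong (_-_ (+ 1)) 1+xd≡yM ⟩
    + 1 - y * M         ≡⟨ solve (y ∷ M ∷ []) ⟩
    + 1 + - y * M       ∎
    where open ≡-Reasoning

Bézout-ℤ : ∀ {d M} → Bézout.Identity 1 d M → Σ ℤ λ a → Σ ℤ λ b → a * + d ≡ + 1 + b * + M
Bézout-ℤ {d} {M} (Bézout.+- x y 1+yM≡xd) =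
  + x , + y , trans (sym (ℤ.pos-* x d)) (trans (cong +_ (sym 1+yM≡xd)) (pos-1+* y M))
Bézout-ℤ {d} {M} (Bézout.-+ x y 1+xd≡yM) =
  - + x , - + y , 1+xd≡yM⇒[-x]d≡1+[-y]M (+ x) (+ d) (+ y) (+ M)
                    (trans (sym (pos-1+* x d)) (trans (cong +_ 1+xd≡yM) (ℤ.pos-* y M)))

mod-inverse : ∀ {d M} → gcd d M ≡ 1 → Σ ℤ λ a → a * + d ≈ + 1 [mod + M ]
mod-inverse gcd≡1 with Bézout-ℤ (coprime-Bézout (gcd≡1⇒coprime gcd≡1))
... | a , b , ad≡1+bM = a , ≈-mod-trans (≈-mod-reflexive ad≡1+bM) (+-multiple≈-mod (+ 1) b)

∣⇒≈-mod-0 : ∀ {m a} → m Signed.∣ a → a ≈ + 0 [mod m ]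
∣⇒≈-mod-0 {a = a} m∣a = m∣a by solve (a ∷ [])

invertible-mod⇒coprime : ∀ {x p} s → s * + x ≈ + 1 [mod + p ] → gcd x p ≡ 1
invertible-mod⇒coprime {x} {p} s sx≈1 =
  coprime⇒gcd≡1 λ {i} (i∣x , i∣p) →
    ∣1⇒≡1 (∣⇒∣ᵤ (m∣a-b (1≈0 (∣ᵤ⇒∣ {+ i} i∣x) (∣ᵤ⇒∣ {+ i} i∣p))))
  where
  1≈0 : ∀ {i} → + i Signed.∣ + x → + i Signed.∣ + p → + 1 ≈ + 0 [mod + i ]
  1≈0 {i} i∣x i∣p = begin
    + 1     ≈⟨ ≈-mod-sym (≈-mod-divisor i∣p sx≈1) ⟩
    s * + x ≈⟨ *-congˡ-mod s (∣⇒≈-mod-0 i∣x) ⟩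
    s * + 0 ≡⟨ ℤ.*-zeroʳ s ⟩
    + 0     ∎
    where open ≈-mod-Reasoning (+ i)

positive-representative : ∀ {p} → 0 < p → (x : ℤ) → Σ ℕ λ r → 0 < r × + r ≈ x [mod + p ]
positive-representative {p} 0<p x =
  p ℕ.+ x %ℕ p , ℕ.<-≤-trans 0<p (ℕ.m≤m+n p _) ,
  ≈-mod-trans (≈-mod-reflexive p+x%p≡x+[1-x/p]p) (+-multiple≈-mod x (+ 1 - x /ℕ p))
  where
  instance
    p≢0 : NonZero p
    p≢0 = >-nonZero 0<p
  shift : ∀ P ρ D → P + ρ ≡ (ρ + D * P) + (+ 1 - D) * P
  shift = solve-∀
  p+x%p≡x+[1-x/p]p : + (p ℕ.+ x %ℕ p) ≡ x + (+ 1 - x /ℕ p) * + p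
  p+x%p≡x+[1-x/p]p = trans (shift (+ p) (+ (x %ℕ p)) (x /ℕ p))
    (cong (_+ (+ 1 - x /ℕ p) * + p) (sym (a≡a%ℕn+[a/ℕn]*n x p)))

^-≈-mod-1 : ∀ {m} b l → + b ≈ + 1 [mod m ] → + (b ^ l) ≈ + 1 [mod m ]
^-≈-mod-1 b zero    _   = ≈-mod-refl
^-≈-mod-1 {m} b (suc l) b≈1 = begin
  + (b ^ suc l)   ≡⟨ ℤ.pos-* b (b ^ l) ⟩
  + b * + (b ^ l) ≈⟨ *-cong-mod b≈1 (^-≈-mod-1 b l b≈1) ⟩
  + 1             ∎
  where open ≈-mod-Reasoning m

q≈-1 : ∀ q → + q ≈ - + 1 [mod + (q ℕ.+ 1) ]
q≈-1 q = mod-by (divides (+ 1) (sym (ℤ.*-identityˡ (+ (q ℕ.+ 1)))))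

q*q≈1 : ∀ q → + (q ℕ.* q) ≈ + 1 [mod + (q ℕ.+ 1) ]
q*q≈1 q = ≈-mod-trans (≈-mod-reflexive (ℤ.pos-* q q)) (*-cong-mod (q≈-1 q) (q≈-1 q))

q²∸1≡[q-1][q+1] : ∀ {q} → 1 ≤ q → + (q ^ 2 ∸ 1) ≡ (+ q - + 1) * + (q ℕ.+ 1)
q²∸1≡[q-1][q+1] {q} 1≤q = begin
  + (q ^ 2 ∸ 1)                ≡⟨ pos-∸ (ℕ.*-mono-≤ 1≤q (ℕ.*-mono-≤ 1≤q (ℕ.≤-refl {1}))) ⟩
  + (q ℕ.* (q ℕ.* 1)) - + 1    ≡⟨ cong (_- + 1) (trans (ℤ.pos-* q _) (cong (+ q *_) (ℤ.pos-* q 1))) ⟩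
  + q * (+ q * + 1) - + 1      ≡⟨ difference-of-squares (+ q) ⟩
  (+ q - + 1) * (+ q + + 1)    ∎
  where
  open ≡-Reasoning
  difference-of-squares : ∀ x → x * (x * + 1) - + 1 ≡ (x - + 1) * (x + + 1)
  difference-of-squares = solve-∀

2^l*2^[m+l[2k+1]]≡2^m*[2^[1+k]²]^l : ∀ k l m →
  2 ^ l ℕ.* 2 ^ (m ℕ.+ l ℕ.* (2 ℕ.* k ℕ.+ 1)) ≡ 2 ^ m ℕ.* (2 ^ suc k ℕ.* 2 ^ suc k) ^ l
2^l*2^[m+l[2k+1]]≡2^m*[2^[1+k]²]^l k l m = begin
  2 ^ l ℕ.* 2 ^ n                            ≡⟨ ℕ.^-distribˡ-+-* 2 l n ⟨
  2 ^ (l ℕ.+ n)                              ≡⟨ cong (2 ^_) exponents ⟩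
  2 ^ (m ℕ.+ (suc k ℕ.+ suc k) ℕ.* l)        ≡⟨ ℕ.^-distribˡ-+-* 2 m _ ⟩
  2 ^ m ℕ.* 2 ^ ((suc k ℕ.+ suc k) ℕ.* l)    ≡⟨ cong (2 ^ m ℕ.*_) (ℕ.^-*-assoc 2 (suc k ℕ.+ suc k) l) ⟨
  2 ^ m ℕ.* (2 ^ (suc k ℕ.+ suc k)) ^ l      ≡⟨ cong (λ x → 2 ^ m ℕ.* x ^ l) (ℕ.^-distribˡ-+-* 2 (suc k) (suc k)) ⟩
  2 ^ m ℕ.* (2 ^ suc k ℕ.* 2 ^ suc k) ^ l    ∎
  where
  open ≡-Reasoning
  n : ℕ
  n = m ℕ.+ l ℕ.* (2 ℕ.* k ℕ.+ 1)
  exponents : l ℕ.+ n ≡ m ℕ.+ (suc k ℕ.+ suc k) ℕ.* l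
  exponents = rearrange k l m
    where
    rearrange : ∀ k l m → l ℕ.+ (m ℕ.+ l ℕ.* (2 ℕ.* k ℕ.+ 1)) ≡ m ℕ.+ (suc k ℕ.+ suc k) ℕ.* l
    rearrange = ℕ-Solver.solve-∀

2^l*2^[m+l[2k+1]]≈2^m : ∀ k l m →
  + (2 ^ l) * + (2 ^ (m ℕ.+ l ℕ.* (2 ℕ.* k ℕ.+ 1))) ≈ + (2 ^ m) [mod + (2 ^ suc k ℕ.+ 1) ]
2^l*2^[m+l[2k+1]]≈2^m k l m = begin
  + (2 ^ l) * + (2 ^ n)            ≡⟨ ℤ.pos-* (2 ^ l) (2 ^ n) ⟨
  + (2 ^ l ℕ.* 2 ^ n)              ≡⟨ cong +_ (2^l*2^[m+l[2k+1]]≡2^m*[2^[1+k]²]^l k l m) ⟩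
  + (2 ^ m ℕ.* (q ℕ.* q) ^ l)      ≡⟨ ℤ.pos-* (2 ^ m) _ ⟩
  + (2 ^ m) * + ((q ℕ.* q) ^ l)    ≈⟨ *-congˡ-mod (+ (2 ^ m)) (^-≈-mod-1 (q ℕ.* q) l (q*q≈1 q)) ⟩
  + (2 ^ m) * + 1                  ≡⟨ ℤ.*-identityʳ (+ (2 ^ m)) ⟩
  + (2 ^ m)                        ∎
  where
  open ≈-mod-Reasoning (+ (2 ^ suc k ℕ.+ 1))
  q n : ℕ
  q = 2 ^ suc k
  n = m ℕ.+ l ℕ.* (2 ℕ.* k ℕ.+ 1)

module _ {p : ℤ} (Q R T a : ℤ) (a[Q-R]≈1 : a * (Q - R) ≈ + 1 [mod p ]) (QT≈R : Q * T ≈ R [mod p ]) where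
  open ≈-mod-Reasoning p

  -Ra[T-1]≈T : - R * a * (T - + 1) ≈ T [mod p ]
  -Ra[T-1]≈T = begin
    - R * a * (T - + 1)       ≡⟨ solve (R ∷ a ∷ T ∷ []) ⟩
    a * R - R * a * T         ≈⟨ +-congʳ-mod (- (R * a * T)) (*-congˡ-mod a (≈-mod-sym QT≈R)) ⟩
    a * (Q * T) - R * a * T   ≡⟨ solve (Q ∷ R ∷ a ∷ T ∷ []) ⟩
    T * (a * (Q - R))         ≈⟨ *-congˡ-mod T a[Q-R]≈1 ⟩
    T * + 1                   ≡⟨ ℤ.*-identityʳ T ⟩
    T                         ∎

  Qa[T-1]≈-1 : Q * a * (T - + 1) ≈ - + 1 [mod p ]
  Qa[T-1]≈-1 = begin
    Q * a * (T - + 1)         ≡⟨ solve (Q ∷ a ∷ T ∷ []) ⟩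
    a * (Q * T) - a * Q       ≈⟨ +-congʳ-mod (- (a * Q)) (*-congˡ-mod a QT≈R) ⟩
    a * R - a * Q             ≡⟨ solve (Q ∷ R ∷ a ∷ []) ⟩
    - (a * (Q - R))           ≈⟨ -‿cong-mod a[Q-R]≈1 ⟩
    - + 1                     ∎

d*[c*a]≈c : ∀ {p} d c a → a * d ≈ + 1 [mod p ] → d * (c * a) ≈ c [mod p ]
d*[c*a]≈c {p} d c a ad≈1 = begin
  d * (c * a) ≡⟨ solve (a ∷ c ∷ d ∷ []) ⟩
  c * (a * d) ≈⟨ *-congˡ-mod c ad≈1 ⟩
  c * + 1     ≡⟨ ℤ.*-identityʳ c ⟩
  c           ∎
  where open ≈-mod-Reasoning p

d[1+te]≈D+ec : ∀ {e p d D t c} → d ≈ D [mod e * p ] → d * t ≈ c [mod p ] →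
               d * (+ 1 + t * e) ≈ D + e * c [mod e * p ]
d[1+te]≈D+ec {e} {p} {d} {D} {t} {c} d≈D dt≈c = begin
  d * (+ 1 + t * e) ≡⟨ solve (d ∷ t ∷ e ∷ []) ⟩
  d + e * (d * t)   ≈⟨ +-cong-mod d≈D (*-scale-mod e dt≈c) ⟩
  D + e * c         ∎
  where open ≈-mod-Reasoning (e * p)

exponent-lift : ∀ {q d D c} t → 1 ≤ q →
                + d ≈ D [mod + (q ^ 2 ∸ 1) ] → + d * + t ≈ c [mod + (q ℕ.+ 1) ] →
                + (d ℕ.* (1 ℕ.+ t ℕ.* (q ∸ 1))) ≈ D + (+ q - + 1) * c [mod + (q ^ 2 ∸ 1) ]
exponent-lift {q} {d} {D} {c} t 1≤q d≈D dt≈c = begin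
  + (d ℕ.* (1 ℕ.+ t ℕ.* (q ∸ 1)))   ≡⟨ as-integers ⟩
  + d * (+ 1 + + t * (+ q - + 1))   ≈⟨ unfactor (d[1+te]≈D+ec (factor d≈D) dt≈c) ⟩
  D + (+ q - + 1) * c               ∎
  where
  open ≈-mod-Reasoning (+ (q ^ 2 ∸ 1))
  factor : ∀ {a b} → a ≈ b [mod + (q ^ 2 ∸ 1) ] → a ≈ b [mod (+ q - + 1) * + (q ℕ.+ 1) ]
  factor {a} {b} = subst (_≈_[mod_] a b) (q²∸1≡[q-1][q+1] 1≤q)
  unfactor : ∀ {a b} → a ≈ b [mod (+ q - + 1) * + (q ℕ.+ 1) ] → a ≈ b [mod + (q ^ 2 ∸ 1) ]
  unfactor {a} {b} = subst (_≈_[mod_] a b) (sym (q²∸1≡[q-1][q+1] 1≤q))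
  as-integers : + (d ℕ.* (1 ℕ.+ t ℕ.* (q ∸ 1))) ≡ + d * (+ 1 + + t * (+ q - + 1))
  as-integers = trans (ℤ.pos-* d _)
    (cong (+ d *_) (trans (pos-1+* t (q ∸ 1)) (cong (λ x → + 1 + + t * x) (pos-∸ 1≤q))))

module WitnessesRS (q : ℕ) {d Q R T : ℕ} (a : ℤ)
  (ad≈1 : a * + d ≈ + 1 [mod + (q ℕ.+ 1) ])
  (d≈Q-R : + d ≈ + Q - + R [mod + (q ℕ.+ 1) ])
  (QT≈R : + Q * + T ≈ + R [mod + (q ℕ.+ 1) ])
  (1≤T : 1 ≤ T)
  where

  private
    0<q+1 : 0 < q ℕ.+ 1
    0<q+1 = ℕ.m≤n+m 1 q

    a[Q-R]≈1 : a * (+ Q - + R) ≈ + 1 [mod + (q ℕ.+ 1) ]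
    a[Q-R]≈1 = ≈-mod-trans (*-congˡ-mod a (≈-mod-sym d≈Q-R)) ad≈1

    r-rep : Σ ℕ λ r → 0 < r × + r ≈ - + R * a [mod + (q ℕ.+ 1) ]
    r-rep = positive-representative 0<q+1 (- + R * a)

    s-rep : Σ ℕ λ s → 0 < s × + s ≈ + Q * a [mod + (q ℕ.+ 1) ]
    s-rep = positive-representative 0<q+1 (+ Q * a)

    T∸1≈T-1 : + (T ∸ 1) ≈ + T - + 1 [mod + (q ℕ.+ 1) ]
    T∸1≈T-1 = ≈-mod-reflexive (pos-∸ 1≤T)

  r s : ℕ
  r = proj₁ r-rep
  s = proj₁ s-rep

  0<r : 0 < r
  0<r = proj₁ (proj₂ r-rep)

  0<s : 0 < s
  0<s = proj₁ (proj₂ s-rep)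

  r[T-1]≈T : + r * + (T ∸ 1) ≈ + T [mod + (q ℕ.+ 1) ]
  r[T-1]≈T = ≈-mod-trans (*-cong-mod (proj₂ (proj₂ r-rep)) T∸1≈T-1)
    (-Ra[T-1]≈T (+ Q) (+ R) (+ T) a a[Q-R]≈1 QT≈R)

  s[T-1]≈-1 : + s * + (T ∸ 1) ≈ - + 1 [mod + (q ℕ.+ 1) ]
  s[T-1]≈-1 = ≈-mod-trans (*-cong-mod (proj₂ (proj₂ s-rep)) T∸1≈T-1)
    (Qa[T-1]≈-1 (+ Q) (+ R) (+ T) a a[Q-R]≈1 QT≈R)

  gcd[T-1,q+1]≡1 : gcd (T ∸ 1) (q ℕ.+ 1) ≡ 1
  gcd[T-1,q+1]≡1 = invertible-mod⇒coprime (- + s)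
    (≈-mod-trans (≈-mod-reflexive (sym (ℤ.neg-distribˡ-* (+ s) (+ (T ∸ 1))))) (-‿cong-mod s[T-1]≈-1))

  dr≈-R : + d * + r ≈ - + R [mod + (q ℕ.+ 1) ]
  dr≈-R = ≈-mod-trans (*-congˡ-mod (+ d) (proj₂ (proj₂ r-rep))) (d*[c*a]≈c (+ d) (- + R) a ad≈1)

  ds≈Q : + d * + s ≈ + Q [mod + (q ℕ.+ 1) ]
  ds≈Q = ≈-mod-trans (*-congˡ-mod (+ d) (proj₂ (proj₂ s-rep))) (d*[c*a]≈c (+ d) (+ Q) a ad≈1)

private
  shift-by-[q-1]R : ∀ Q R u q → Q + R + (u - R) * (q + + 1) ≡ Q - R + u * (q + + 1) + (q - + 1) * - R
  shift-by-[q-1]R = solve-∀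

  shift-by-[q-1]Q : ∀ Q R u q → - (Q + R) + (u + Q) * (q + + 1) ≡ Q - R + u * (q + + 1) + (q - + 1) * Q
  shift-by-[q-1]Q = solve-∀

mainTheorem2 :
    ∀ {c ℓ'} (k l m : ℕ) → 0 < k → 0 < l → 0 < m → l ≢ m →
    (u : ℤ) (d₁ d₂ d₃ : ℕ) → 0 < d₁ → 0 < d₂ → 0 < d₃ →
    let q = 2 ^ k
        Q = 2 ^ l
        R = 2 ^ m
        qq = + (q ^ 2 ∸ 1)
        q+1 = + (q ℕ.+ 1)
    in
    (+ d₁) ≡ (+ Q ℤ.- + R ℤ.+ u ℤ.* q+1) [modℤ qq ] →
    (+ d₂) ≡ (+ Q ℤ.+ + R ℤ.+ (u ℤ.- + R) ℤ.* q+1) [modℤ qq ] →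
    (+ d₃) ≡ (ℤ.- (+ Q ℤ.+ + R) ℤ.+ (u ℤ.+ + Q) ℤ.* q+1) [modℤ qq ] →
    gcd d₁ (q ^ 2 ∸ 1) ≡ 1 →
    (F : FiniteField c ℓ' (q ^ 2)) →
    let open Poly F in
    Σ ℕ λ n → let T = 2 ^ n in
      0 < n × gcd (T ∸ 1) (q ℕ.+ 1) ≡ 1 ×
      Σ ℕ λ r → Σ ℕ λ s →
        0 < r × 0 < s ×
        (+ r ℤ.* + (T ∸ 1)) ≡ (+ T) [modℤ q+1 ] ×
        (+ s ℤ.* + (T ∸ 1)) ≡ (ℤ.- + 1) [modℤ q+1 ] ×
        MultEquiv (mono d₁ ∷ mono d₂ ∷ mono d₃ ∷ [])
                  (mono 1 ∷ mono (1 ℕ.+ r ℕ.* (q ∸ 1)) ∷ mono (1 ℕ.+ s ℕ.* (q ∸ 1)) ∷ [])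
mainTheorem2 zero _ _ () _ _ _ _ _ _ _ _ _ _ _ _ _ _ _
mainTheorem2 (suc k) l m _ _ 0<m _ u d₁ d₂ d₃ 0<d₁ 0<d₂ 0<d₃ h₁ h₂ h₃ gcd[d₁,q²-1]≡1 F =
  n , ℕ.<-≤-trans 0<m (ℕ.m≤m+n m _) , gcd[T-1,q+1]≡1 ,
  r , s , 0<r , 0<s , toModℤ r[T-1]≈T , toModℤ s[T-1]≈-1 ,
  monomials-multEquiv F d₁ (d₁ ∷ d₂ ∷ d₃ ∷ []) (1 ∷ e₂ ∷ e₃ ∷ []) 0<d₁ gcd[d₁,q²-1]≡1
    (cong redExp (sym (ℕ.*-identityʳ d₁)) Pointwise.∷ same-reduction 0<d₂ d₂≈d₁e₂ Pointwise.∷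
     same-reduction 0<d₃ d₃≈d₁e₃ Pointwise.∷ Pointwise.[])
  where
  open Poly F using (redExp)
  q Q R n : ℕ
  q = 2 ^ suc k
  Q = 2 ^ l
  R = 2 ^ m
  n = m ℕ.+ l ℕ.* (2 ℕ.* k ℕ.+ 1)
  1≤q : 1 ≤ q
  1≤q = ℕ.m^n>0 2 (suc k)
  modulo-q+1 : ∀ {a b} → a ≈ b [mod + (q ^ 2 ∸ 1) ] → a ≈ b [mod + (q ℕ.+ 1) ]
  modulo-q+1 = ≈-mod-divisor (divides (+ q - + 1) (q²∸1≡[q-1][q+1] 1≤q))
  h₁′ : + d₁ ≈ + Q - + R + u * + (q ℕ.+ 1) [mod + (q ^ 2 ∸ 1) ]
  h₁′ = fromModℤ h₁
  d₁≈Q-R : + d₁ ≈ + Q - + R [mod + (q ℕ.+ 1) ]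
  d₁≈Q-R = ≈-mod-trans (modulo-q+1 h₁′) (+-multiple≈-mod (+ Q - + R) u)
  inverse : Σ ℤ λ a → a * + d₁ ≈ + 1 [mod + (q ^ 2 ∸ 1) ]
  inverse = mod-inverse {d₁} {q ^ 2 ∸ 1} gcd[d₁,q²-1]≡1
  open WitnessesRS q (proj₁ inverse) (modulo-q+1 (proj₂ inverse)) d₁≈Q-R
    (2^l*2^[m+l[2k+1]]≈2^m k l m) (ℕ.m^n>0 2 n)
  e₂ e₃ : ℕ
  e₂ = 1 ℕ.+ r ℕ.* (q ∸ 1)
  e₃ = 1 ℕ.+ s ℕ.* (q ∸ 1)
  same-reduction : ∀ {d t} → 0 < d → + d ≈ + (d₁ ℕ.* (1 ℕ.+ t)) [mod + (q ^ 2 ∸ 1) ] →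
                   redExp d ≡ redExp (d₁ ℕ.* (1 ℕ.+ t))
  same-reduction 0<d = redExp-cong F 0<d (ℕ.*-mono-≤ 0<d₁ (s≤s z≤n))
  open ≈-mod-Reasoning (+ (q ^ 2 ∸ 1))
  d₂≈d₁e₂ : + d₂ ≈ + (d₁ ℕ.* e₂) [mod + (q ^ 2 ∸ 1) ]
  d₂≈d₁e₂ = begin
    + d₂                                               ≈⟨ fromModℤ h₂ ⟩
    + Q + + R + (u - + R) * + (q ℕ.+ 1)                ≡⟨ shift-by-[q-1]R (+ Q) (+ R) u (+ q) ⟩
    + Q - + R + u * + (q ℕ.+ 1) + (+ q - + 1) * - + R  ≈⟨ exponent-lift r 1≤q h₁′ dr≈-R ⟨
    + (d₁ ℕ.* e₂)                                      ∎
  d₃≈d₁e₃ : + d₃ ≈ + (d₁ ℕ.* e₃) [mod + (q ^ 2 ∸ 1) ]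
  d₃≈d₁e₃ = begin
    + d₃                                               ≈⟨ fromModℤ h₃ ⟩
    - (+ Q + + R) + (u + + Q) * + (q ℕ.+ 1)            ≡⟨ shift-by-[q-1]Q (+ Q) (+ R) u (+ q) ⟩
    + Q - + R + u * + (q ℕ.+ 1) + (+ q - + 1) * + Q    ≈⟨ exponent-lift s 1≤q h₁′ ds≈Q ⟨
    + (d₁ ℕ.* e₃)                                      ∎
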